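{- Let $\bm\lambda=(R_1,\dots,R_n)$ be a horizontal-strip with a sequence of rows $(R_{j_1},\dots,R_{j_k})$ such that $k\ge2$, $j_1<\cdots<j_k$, $M_{j_t,j_{t'}}=0$ for all $1\le t<t'\le k$, and let $h$ be an index with $h<j_1$ or $h>j_k$ such that $M_{j_t,h}>0$ for every $1\le t\le k$. Then $M_{j_1,h}+\cdots+M_{j_k,h}\ge|R_h|+1$ if and only if $l(R_{j_{t+1}})=r(R_{j_t})+1$ for every $1\le t\le k-1$ and $$l(R_{j_1})+\chi(j_1>h)\le l(R_h)\le r(R_h)+\chi(h>j_k)\le r(R_{j_k}).$$
   Context: A row is $R=a/b=\{(1,j):b+1\le j\le a\}$ ($a\ge b\ge0$ integers); $l(R)=b$, $r(R)=a-1$, $|R|$ its number of cells, $R^+=(a+1)/(b+1)$. For rows $R,R'$: $M(R,R')=|R\cap R'|$ if $l(R)\le l(R')$, else $|R\cap R'^+|$. For a horizontal-strip (sequence of rows) $(R_1,\dots,R_n)$, $M_{i,j}=M(R_{\min(i,j)},R_{\max(i,j)})$ for $i\ne j$. $\chi(P)$ is $1$ if $P$ holds and $0$ otherwise. (A sequence as in the claim is called strict when some such $h$ satisfies $M_{j_1,h}+\dots+M_{j_k,h}\ge|R_h|+1$.) -}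

module Defs where

open import Data.Nat as ℕ using (ℕ; zero; suc; _∸_; _⊔_; _⊓_)
open import Data.Integer as ℤ using (ℤ; +_)
open import Data.Fin as Fin using (Fin; zero; suc; toℕ)
open import Relation.Nullary using (Dec; yes; no)

-- A row a/b = {(1,j) : b+1 ≤ j ≤ a}, with a ≥ b ≥ 0.
record Row : Set where
  constructor _/_∣_
  field
    a   : ℕ
    b   : ℕ
    b≤a : b ℕ.≤ a
open Row public

-- l(R) = b ; r(R) = a - 1 (an integer: may be -1 for the empty row 0/0)
l : Row → ℤ
l R = + b R

r : Row → ℤ
r R = + a R ℤ.- + 1

∣_∣ᴿ : Row → ℕ
∣ R ∣ᴿ = a R ∸ b R

∣_∩_∣ : Row → Row → ℕ
∣ R ∩ R' ∣ = (a R ⊓ a R') ∸ (b R ⊔ b R')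

_⁺ : Row → Row
R ⁺ = suc (a R) / suc (b R) ∣ ℕ.s≤s (b≤a R)

M : Row → Row → ℕ
M R R' with b R ℕ.≤? b R'
... | yes _ = ∣ R ∩ R' ∣
... | no  _ = ∣ R ∩ (R' ⁺) ∣

HStrip : ℕ → Set
HStrip n = Fin n → Row

Mᵢⱼ : ∀ {n} → HStrip n → Fin n → Fin n → ℕ
Mᵢⱼ λ′ i j with i Fin.≤? j
... | yes _ = M (λ′ i) (λ′ j)
... | no  _ = M (λ′ j) (λ′ i)

χ : ∀ {p} {P : Set p} → Dec P → ℕ
χ (yes _) = 1
χ (no  _) = 0

∑ : ∀ {k} → (Fin k → ℕ) → ℕ
∑ {zero}  f = 0
∑ {suc k} f = f zero ℕ.+ ∑ (λ t → f (suc t))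

{-# OPTIONS --safe #-}
-- Read the row a/b as the column interval (b, a] and let W = (l(R_h), r(R_h) + 2] be R_h together with
-- the next column, so |W| = |R_h| + 1. Each M_{j_t,h} is at most the number of columns W shares with
-- R_{j_t}, shifted one column right when h < j_1, and the bound is exact unless that interval contains
-- W. The vanishing M_{j_t,j_t'} make these intervals pairwise disjoint, and an interval lying left of
-- one with smaller index is separated from it by a gap column. Charging each gap column to the interval
-- on its right shows that disjoint intervals share at most |W| columns with W, with equality only if
-- they tile W in index order: the first starts at or before W, each starts where the previous one
-- ends, and the last ends at or after W. Conversely, as k ≥ 2 no interval of such a tiling contains W,
-- so all bounds are exact.
module Submission where

open import Defs
open import Data.Nat as ℕ using (ℕ; zero; suc; _+_; _∸_; _⊔_; _⊓_; _≤_; _<_; z≤n; s≤s; _≤?_)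
open import Data.Nat.Properties
open import Data.Integer as ℤ using (+_; +≤+; -≤+; -≤-)
import Data.Integer.Properties as ℤ
open import Data.Fin as Fin using (Fin; zero; suc; inject₁; fromℕ)
import Data.Fin.Properties as Fin
open import Data.Product using (_×_; _,_; proj₁; proj₂; swap)
open import Data.Product.Function.NonDependent.Propositional using (_×-⇔_)
open import Data.Sum as Sum using (_⊎_; inj₁; inj₂)
open import Data.Empty using (⊥-elim)
open import Relation.Nullary using (yes; no)
open import Relation.Nullary.Decidable using (dec-yes-recompute; dec-no)
open import Relation.Binary.PropositionalEquality
open import Function.Base using (_∘_)
open import Function.Bundles using (_⇔_; mk⇔; Equivalence)
import Function.Properties.Equivalence as ⇔
open import Algebra.Properties.CommutativeSemigroup +-commutativeSemigroup
  using (interchange; x∙yz≈y∙xz)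

private variable
  k : ℕ
  lo hi lo′ hi′ x y x′ y′ m m′ n n′ o z : ℕ

∸-split : n ≤ o → o ≤ m → m ∸ n ≡ (o ∸ n) + (m ∸ o)
∸-split {n} {o} {m} n≤o o≤m = begin
  m ∸ n               ≡⟨ cong (_∸ n) (sym (m∸n+n≡m o≤m)) ⟩
  (m ∸ o + o) ∸ n     ≡⟨ +-∸-assoc (m ∸ o) n≤o ⟩
  (m ∸ o) + (o ∸ n)   ≡⟨ +-comm (m ∸ o) (o ∸ n) ⟩
  (o ∸ n) + (m ∸ o)   ∎
  where open ≡-Reasoning

+-tight : m ≤ m′ → n ≤ n′ → m′ + n′ ≤ m + n → m′ ≤ m × n′ ≤ n
+-tight {m} {m′} {n} {n′} m≤m′ n≤n′ tight =
    +-cancelʳ-≤ n′ m′ m (≤-trans tight (+-monoʳ-≤ m n≤n′))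
  , +-cancelˡ-≤ m n′ n (≤-trans (+-monoˡ-≤ n′ m≤m′) tight)

-- |(lo, hi] ∩ (x, y]|, so that ∣ R ∩ R′ ∣ = common (b R) (a R) (b R′) (a R′).
common : ℕ → ℕ → ℕ → ℕ → ℕ
common lo hi x y = (hi ⊓ y) ∸ (lo ⊔ x)

common-comm : ∀ lo hi x y → common lo hi x y ≡ common x y lo hi
common-comm lo hi x y = cong₂ _∸_ (⊓-comm hi y) (⊔-comm lo x)

common>0⇒ : ∀ lo hi → 0 < common lo hi x y → lo ⊔ x < hi ⊓ y
common>0⇒ lo hi pos = m∸n≢0⇒n<m (n>0⇒n≢0 pos)

common>0⇒lo<hi : ∀ lo hi → 0 < common lo hi x y → lo < hi
common>0⇒lo<hi {x} {y} lo hi pos = m<n⊓o⇒m<n hi y (m⊔n<o⇒m<o lo x (common>0⇒ lo hi pos))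

common>0⇒lo<y : ∀ lo hi → 0 < common lo hi x y → lo < y
common>0⇒lo<y {x} {y} lo hi pos = m<n⊓o⇒m<o hi y (m⊔n<o⇒m<o lo x (common>0⇒ lo hi pos))

common>0⇒x<hi : ∀ lo hi → 0 < common lo hi x y → x < hi
common>0⇒x<hi {x} {y} lo hi pos = m<n⊓o⇒m<n hi y (m⊔n<o⇒n<o lo x (common>0⇒ lo hi pos))

common>0⇒x<y : ∀ lo hi → 0 < common lo hi x y → x < y
common>0⇒x<y {x} {y} lo hi pos = m<n⊓o⇒m<o hi y (m⊔n<o⇒n<o lo x (common>0⇒ lo hi pos))

common≡0⇒apart : lo < hi → x < y → common lo hi x y ≡ 0 → hi ≤ x ⊎ y ≤ lo
common≡0⇒apart {lo} {hi} {x} {y} lo<hi x<y empty with hi ≤? x | y ≤? lo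
... | yes hi≤x | _        = inj₁ hi≤x
... | no _     | yes y≤lo = inj₂ y≤lo
... | no hi≰x  | no y≰lo  = ⊥-elim (<⇒≢ (m<n⇒0<n∸m lo⊔x<hi⊓y) (sym empty))
  where
  lo⊔x<hi⊓y : lo ⊔ x < hi ⊓ y
  lo⊔x<hi⊓y = ⊓-pres-m< (⊔-pres-<m lo<hi (≰⇒> hi≰x)) (⊔-pres-<m (≰⇒> y≰lo) x<y)

common-monoʸ : y ≤ y′ → common lo hi x y ≤ common lo hi x y′
common-monoʸ {lo = lo} {hi} {x} y≤y′ = ∸-monoˡ-≤ (lo ⊔ x) (⊓-monoʳ-≤ hi y≤y′)

common-capʸ : hi ≤ y → hi ≤ y′ → common lo hi x y ≡ common lo hi x y′
common-capʸ {lo = lo} {x = x} hi≤y hi≤y′ =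
  cong (_∸ (lo ⊔ x)) (trans (m≤n⇒m⊓n≡m hi≤y) (sym (m≤n⇒m⊓n≡m hi≤y′)))

common-capˣ : x ≤ lo → x′ ≤ lo → common lo hi x y ≡ common lo hi x′ y
common-capˣ {hi = hi} {y = y} x≤lo x′≤lo =
  cong ((hi ⊓ y) ∸_) (trans (m≥n⇒m⊔n≡m x≤lo) (sym (m≥n⇒m⊔n≡m x′≤lo)))

common-window : lo ≤ x → y ≤ hi → common lo hi x y ≡ y ∸ x
common-window lo≤x y≤hi = cong₂ _∸_ (m≥n⇒m⊓n≡n y≤hi) (m≤n⇒m⊔n≡n lo≤x)

common-split-window : x ≤ z → z ≤ y → common lo hi x y ≡ common lo hi x z + common lo hi z y
common-split-window {x} {p} {y} {lo} {hi} x≤p p≤y with ≤-total hi p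
... | inj₁ hi≤p
  rewrite m≤n⇒m⊓n≡m hi≤p | m≤n⇒m⊓n≡m (≤-trans hi≤p p≤y)
        | m≤n⇒m∸n≡0 (≤-trans hi≤p (m≤n⊔m lo p)) = sym (+-identityʳ _)
... | inj₂ p≤hi with ≤-total lo p
...   | inj₁ lo≤p rewrite m≥n⇒m⊓n≡n p≤hi | m≤n⇒m⊔n≡n lo≤p =
  ∸-split (⊔-lub lo≤p x≤p) (⊓-glb p≤hi p≤y)
...   | inj₂ p≤lo rewrite m≥n⇒m⊓n≡n p≤hi | m≥n⇒m⊔n≡m p≤lo
        | m≥n⇒m⊔n≡m (≤-trans x≤p p≤lo) | m≤n⇒m∸n≡0 p≤lo = refl

common-split-interval : ∀ x y → lo ≤ z → z ≤ hi →
  common lo hi x y ≡ common lo z x y + common z hi x y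
common-split-interval {lo} {p} {hi} x y lo≤p p≤hi = begin
  common lo hi x y                   ≡⟨ common-comm lo hi x y ⟩
  common x y lo hi                   ≡⟨ common-split-window {lo = x} {hi = y} lo≤p p≤hi ⟩
  common x y lo p + common x y p hi ≡⟨ sym (cong₂ _+_ (common-comm lo p x y) (common-comm p hi x y)) ⟩
  common lo p x y + common p hi x y ∎
  where open ≡-Reasoning

common-empty-window : ∀ lo hi x → common lo hi x x ≡ 0
common-empty-window lo hi x = m≤n⇒m∸n≡0 (≤-trans (m⊓n≤n hi x) (m≤n⊔m lo x))

∑-cong : {f g : Fin k → ℕ} → (∀ t → f t ≡ g t) → ∑ f ≡ ∑ g
∑-cong {k = zero}  f≡g = refl
∑-cong {k = suc k} f≡g = cong₂ _+_ (f≡g zero) (∑-cong (f≡g ∘ suc))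

∑-mono-≤ : {f g : Fin k → ℕ} → (∀ t → f t ≤ g t) → ∑ f ≤ ∑ g
∑-mono-≤ {k = zero}  f≤g = z≤n
∑-mono-≤ {k = suc k} f≤g = +-mono-≤ (f≤g zero) (∑-mono-≤ (f≤g ∘ suc))

∑-+ : (f g : Fin k → ℕ) → ∑ (λ t → f t + g t) ≡ ∑ f + ∑ g
∑-+ {k = zero}  f g = refl
∑-+ {k = suc k} f g = begin
  (f zero + g zero) + ∑ (λ t → f (suc t) + g (suc t))
    ≡⟨ cong (_+_ (f zero + g zero)) (∑-+ (f ∘ suc) (g ∘ suc)) ⟩
  (f zero + g zero) + (∑ (f ∘ suc) + ∑ (g ∘ suc))
    ≡⟨ interchange (f zero) (g zero) _ _ ⟩
  (f zero + ∑ (f ∘ suc)) + (g zero + ∑ (g ∘ suc)) ∎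
  where open ≡-Reasoning

∑common : (lo hi : Fin k → ℕ) → ℕ → ℕ → ℕ
∑common lo hi x y = ∑ (λ t → common (lo t) (hi t) x y)

Separated : (lo hi : Fin k → ℕ) → Set
Separated lo hi = ∀ t u → t Fin.< u → hi t ≤ lo u ⊎ hi u < lo t

Meets : (lo hi : Fin k → ℕ) → ℕ → ℕ → Set
Meets lo hi x y = ∀ t → 0 < common (lo t) (hi t) x y

Chain : (lo hi : Fin (suc k) → ℕ) → Set
Chain {k} lo hi = ∀ (t : Fin k) → lo (suc t) ≡ hi (inject₁ t)

Tiling : (lo hi : Fin (suc k) → ℕ) → ℕ → ℕ → Set
Tiling {k} lo hi x y = Chain lo hi × lo zero ≤ x × y ≤ hi (fromℕ k)

Separated-tail : {lo hi : Fin (suc k) → ℕ} → Separated lo hi → Separated (lo ∘ suc) (hi ∘ suc)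
Separated-tail sep t u t<u = sep (suc t) (suc u) (s≤s t<u)

Separated-suc : {lo hi : Fin k → ℕ} → Separated lo hi → Separated (suc ∘ lo) (suc ∘ hi)
Separated-suc sep t u t<u = Sum.map s≤s s≤s (sep t u t<u)

Chain-suc⇔ : {lo hi : Fin (suc k) → ℕ} → Chain (suc ∘ lo) (suc ∘ hi) ⇔ Chain lo hi
Chain-suc⇔ = mk⇔ (λ chain → suc-injective ∘ chain) (λ chain → cong suc ∘ chain)

common<gap-window : x < lo → lo ≤ hi ⊓ y →
  common lo hi x y < ((hi ⊔ (((lo ∸ 1) ⊔ x) ⊓ y)) ⊓ y) ∸ (((lo ∸ 1) ⊔ x) ⊓ y)
common<gap-window {x} {suc c} {hi} {y} (s≤s x≤c) lo≤hi⊓y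
  rewrite m≥n⇒m⊔n≡m x≤c | m≤n⇒m⊓n≡m (≤-trans (n≤1+n c) (≤-trans lo≤hi⊓y (m⊓n≤n hi y))) =
  begin-strict
  (hi ⊓ y) ∸ (suc c ⊔ x) ≡⟨ cong ((hi ⊓ y) ∸_) (m≥n⇒m⊔n≡m (≤-trans x≤c (n≤1+n c))) ⟩
  (hi ⊓ y) ∸ suc c       <⟨ ∸-monoʳ-< (n<1+n c) lo≤hi⊓y ⟩
  (hi ⊓ y) ∸ c           ≤⟨ ∸-monoˡ-≤ c (⊓-monoˡ-≤ y (m≤m⊔n hi c)) ⟩
  ((hi ⊔ c) ⊓ y) ∸ c     ∎
  where open ≤-Reasoning

-- A later interval lying left of (lo₀, hi₀] ends before the gap column lo₀, so within (x, y] it lies in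
-- (x, p]; one lying right of it lies in (q, y]. Counting the gap column in (p, q] makes the bound
-- q ∸ p on the head tight only when lo₀ ≤ x.
module Peel {k} (lo hi : Fin (suc k) → ℕ) {x y} (x≤y : x ≤ y) where

  p q : ℕ
  p = ((lo zero ∸ 1) ⊔ x) ⊓ y
  q = (hi zero ⊔ p) ⊓ y

  x≤p : x ≤ p
  x≤p = ⊓-glb (m≤n⊔m _ x) x≤y

  p≤q : p ≤ q
  p≤q = ⊓-glb (m≤n⊔m (hi zero) p) (m⊓n≤n _ y)

  q≤y : q ≤ y
  q≤y = m⊓n≤n _ y

  length-split : (q ∸ p) + ((p ∸ x) + (y ∸ q)) ≡ y ∸ x
  length-split = begin
    (q ∸ p) + ((p ∸ x) + (y ∸ q)) ≡⟨ x∙yz≈y∙xz (q ∸ p) (p ∸ x) (y ∸ q) ⟩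
    (p ∸ x) + ((q ∸ p) + (y ∸ q)) ≡⟨ cong (_+_ (p ∸ x)) (sym (∸-split p≤q q≤y)) ⟩
    (p ∸ x) + (y ∸ p)             ≡⟨ sym (∸-split x≤p (≤-trans p≤q q≤y)) ⟩
    y ∸ x                         ∎
    where open ≡-Reasoning

  head-≤ : common (lo zero) (hi zero) x y ≤ q ∸ p
  head-≤ = ∸-mono (⊓-monoˡ-≤ y (m≤m⊔n (hi zero) p))
                  (≤-trans (m⊓n≤m _ y) (⊔-monoˡ-≤ x (m∸n≤m (lo zero) 1)))

  gap-empty : hi zero ≤ lo′ ⊎ hi′ < lo zero → common lo′ hi′ p q ≡ 0
  gap-empty {lo′} {hi′} (inj₁ hi₀≤lo′) =
    m≤n⇒m∸n≡0 (≤-trans (m⊓n≤n hi′ q) (≤-trans (m⊓n≤m (hi zero ⊔ p) y) (⊔-monoˡ-≤ p hi₀≤lo′)))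
  gap-empty {lo′} {hi′} (inj₂ hi′<lo₀) =
    m≤n⇒m∸n≡0 (≤-trans (⊓-glb hi′⊓q≤lo₀∸1⊔x (≤-trans (m⊓n≤n hi′ q) q≤y)) (m≤n⊔m lo′ p))
    where
    hi′⊓q≤lo₀∸1⊔x : hi′ ⊓ q ≤ (lo zero ∸ 1) ⊔ x
    hi′⊓q≤lo₀∸1⊔x = ≤-trans (m⊓n≤m hi′ q) (≤-trans (∸-monoˡ-≤ 1 hi′<lo₀) (m≤m⊔n _ x))

  tail-split : hi zero ≤ lo′ ⊎ hi′ < lo zero →
    common lo′ hi′ x y ≡ common lo′ hi′ x p + common lo′ hi′ q y
  tail-split {lo′} {hi′} apart = begin
    common lo′ hi′ x y
      ≡⟨ common-split-window {lo = lo′} {hi = hi′} x≤p (≤-trans p≤q q≤y) ⟩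
    common lo′ hi′ x p + common lo′ hi′ p y
      ≡⟨ cong (_+_ (common lo′ hi′ x p)) (common-split-window {lo = lo′} {hi = hi′} p≤q q≤y) ⟩
    common lo′ hi′ x p + (common lo′ hi′ p q + common lo′ hi′ q y)
      ≡⟨ cong (λ z → common lo′ hi′ x p + (z + common lo′ hi′ q y)) (gap-empty apart) ⟩
    common lo′ hi′ x p + common lo′ hi′ q y ∎
    where open ≡-Reasoning

  ∑-split : Separated lo hi →
    ∑common lo hi x y ≡ common (lo zero) (hi zero) x y
                        + (∑common (lo ∘ suc) (hi ∘ suc) x p + ∑common (lo ∘ suc) (hi ∘ suc) q y)
  ∑-split sep = cong (_+_ (common (lo zero) (hi zero) x y)) (begin
    ∑common (lo ∘ suc) (hi ∘ suc) x y
      ≡⟨ ∑-cong (λ u → tail-split {lo (suc u)} {hi (suc u)} (sep zero (suc u) (s≤s z≤n))) ⟩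
    ∑ (λ u → left u + right u)
      ≡⟨ ∑-+ left right ⟩
    ∑common (lo ∘ suc) (hi ∘ suc) x p + ∑common (lo ∘ suc) (hi ∘ suc) q y ∎)
    where
    open ≡-Reasoning
    left right : Fin k → ℕ
    left u  = common (lo (suc u)) (hi (suc u)) x p
    right u = common (lo (suc u)) (hi (suc u)) q y

  head-tight⇒lo₀≤x : 0 < common (lo zero) (hi zero) x y → q ∸ p ≤ common (lo zero) (hi zero) x y →
    lo zero ≤ x
  head-tight⇒lo₀≤x meets tight with lo zero ≤? x
  ... | yes lo₀≤x = lo₀≤x
  ... | no lo₀≰x  = ⊥-elim (<⇒≱ (common<gap-window (≰⇒> lo₀≰x) lo₀≤hi₀⊓y) tight)
    where
    lo₀≤hi₀⊓y : lo zero ≤ hi zero ⊓ y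
    lo₀≤hi₀⊓y = <⇒≤ (m⊔n<o⇒m<o (lo zero) x (common>0⇒ (lo zero) (hi zero) meets))

∑common≤length : (lo hi : Fin k → ℕ) → Separated lo hi → x ≤ y → ∑common lo hi x y ≤ y ∸ x
∑common≤length {k = zero}  lo hi sep x≤y = z≤n
∑common≤length {k = suc k} {x} {y} lo hi sep x≤y = begin
  ∑common lo hi x y
    ≡⟨ ∑-split sep ⟩
  common (lo zero) (hi zero) x y + (∑common (lo ∘ suc) (hi ∘ suc) x p + ∑common (lo ∘ suc) (hi ∘ suc) q y)
    ≤⟨ +-mono-≤ head-≤ (+-mono-≤ (tail-≤ x≤p) (tail-≤ q≤y)) ⟩
  (q ∸ p) + ((p ∸ x) + (y ∸ q))
    ≡⟨ length-split ⟩
  y ∸ x ∎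
  where
  open Peel lo hi x≤y
  open ≤-Reasoning
  tail-≤ : x′ ≤ y′ → ∑common (lo ∘ suc) (hi ∘ suc) x′ y′ ≤ y′ ∸ x′
  tail-≤ = ∑common≤length (lo ∘ suc) (hi ∘ suc) (Separated-tail sep)

module Tight {k} (lo hi : Fin (suc k) → ℕ) (sep : Separated lo hi) {x y}
             (meets : Meets lo hi x y) (tight : y ∸ x ≤ ∑common lo hi x y) where

  open Peel lo hi (<⇒≤ (common>0⇒x<y (lo zero) (hi zero) (meets zero))) public

  private
    pieces-tight : q ∸ p ≤ common (lo zero) (hi zero) x y
                 × (p ∸ x) + (y ∸ q)
                     ≤ ∑common (lo ∘ suc) (hi ∘ suc) x p + ∑common (lo ∘ suc) (hi ∘ suc) q y
    pieces-tight = +-tight head-≤ (+-mono-≤ (∑common≤length _ _ (Separated-tail sep) x≤p)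
                                           (∑common≤length _ _ (Separated-tail sep) q≤y))
      (begin
        (q ∸ p) + ((p ∸ x) + (y ∸ q)) ≡⟨ length-split ⟩
        y ∸ x                         ≤⟨ tight ⟩
        ∑common lo hi x y             ≡⟨ ∑-split sep ⟩
        _                             ∎)
      where open ≤-Reasoning

  lo₀≤x : lo zero ≤ x
  lo₀≤x = head-tight⇒lo₀≤x (meets zero) (proj₁ pieces-tight)

  tail-tight : y ∸ q ≤ ∑common (lo ∘ suc) (hi ∘ suc) q y
  tail-tight = proj₂ (+-tight (∑common≤length _ _ (Separated-tail sep) x≤p)
                              (∑common≤length _ _ (Separated-tail sep) q≤y)
                              (proj₂ pieces-tight))

  p≡x : p ≡ x
  p≡x = trans (cong (_⊓ y) (m≤n⇒m⊔n≡n (≤-trans (m∸n≤m (lo zero) 1) lo₀≤x)))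
              (m≤n⇒m⊓n≡m (<⇒≤ (common>0⇒x<y (lo zero) (hi zero) (meets zero))))

  q≤hi₀ : q ≤ hi zero
  q≤hi₀ = ≤-trans (m⊓n≤m (hi zero ⊔ p) y) (⊔-lub ≤-refl (≤-trans (≤-reflexive p≡x) (<⇒≤ x<hi₀)))
    where
    x<hi₀ : x < hi zero
    x<hi₀ = common>0⇒x<hi (lo zero) (hi zero) (meets zero)

  tail-meets : Meets (lo ∘ suc) (hi ∘ suc) q y
  tail-meets u = subst (0 <_) (begin
    common (lo (suc u)) (hi (suc u)) x y
      ≡⟨ tail-split {lo (suc u)} {hi (suc u)} (sep zero (suc u) (s≤s z≤n)) ⟩
    common (lo (suc u)) (hi (suc u)) x p + common (lo (suc u)) (hi (suc u)) q y
      ≡⟨ cong (λ z → common (lo (suc u)) (hi (suc u)) x z + common (lo (suc u)) (hi (suc u)) q y) p≡x ⟩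
    common (lo (suc u)) (hi (suc u)) x x + common (lo (suc u)) (hi (suc u)) q y
      ≡⟨ cong (_+ common (lo (suc u)) (hi (suc u)) q y) (common-empty-window (lo (suc u)) (hi (suc u)) x) ⟩
    common (lo (suc u)) (hi (suc u)) q y ∎) (meets (suc u))
    where open ≡-Reasoning

tight⇒tiling : (lo hi : Fin (suc k) → ℕ) → Separated lo hi → Meets lo hi x y →
  y ∸ x ≤ ∑common lo hi x y → Tiling lo hi x y
tight⇒tiling {k = zero} lo hi sep meets tight =
  (λ ()) , lo₀≤x , ≤-trans (m∸n≡0⇒m≤n (n≤0⇒n≡0 tail-tight)) q≤hi₀
  where open Tight lo hi sep meets tight
tight⇒tiling {k = suc k} {x} {y} lo hi sep meets tight = chain , lo₀≤x , proj₂ (proj₂ rest)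
  where
  open Tight lo hi sep meets tight
  rest : Tiling (lo ∘ suc) (hi ∘ suc) q y
  rest = tight⇒tiling (lo ∘ suc) (hi ∘ suc) (Separated-tail sep) tail-meets tail-tight
  lo₁≡hi₀ : lo (suc zero) ≡ hi zero
  lo₁≡hi₀ with sep zero (suc zero) (s≤s z≤n)
  ... | inj₁ hi₀≤lo₁ = ≤-antisym (≤-trans (proj₁ (proj₂ rest)) q≤hi₀) hi₀≤lo₁
  ... | inj₂ hi₁<lo₀ = ⊥-elim (<⇒≱ (common>0⇒x<hi (lo (suc zero)) (hi (suc zero)) (meets (suc zero)))
                                   (≤-trans (<⇒≤ hi₁<lo₀) lo₀≤x))
  chain : Chain lo hi
  chain zero    = lo₁≡hi₀
  chain (suc t) = proj₁ rest t

chain⇒lo₀≤hi-last : (lo hi : Fin (suc k) → ℕ) → (∀ t → lo t ≤ hi t) → Chain lo hi →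
  lo zero ≤ hi (fromℕ k)
chain⇒lo₀≤hi-last {k = zero}  lo hi lo≤hi chain = lo≤hi zero
chain⇒lo₀≤hi-last {k = suc k} lo hi lo≤hi chain =
  ≤-trans (lo≤hi zero) (subst (_≤ hi (fromℕ (suc k))) (chain zero)
    (chain⇒lo₀≤hi-last (lo ∘ suc) (hi ∘ suc) (lo≤hi ∘ suc) (chain ∘ suc)))

∑common-chain : (lo hi : Fin (suc k) → ℕ) → (∀ t → lo t ≤ hi t) → Chain lo hi →
  ∀ x y → ∑common lo hi x y ≡ common (lo zero) (hi (fromℕ k)) x y
∑common-chain {k = zero}  lo hi lo≤hi chain x y = +-identityʳ _
∑common-chain {k = suc k} lo hi lo≤hi chain x y = begin
  common (lo zero) (hi zero) x y + ∑common (lo ∘ suc) (hi ∘ suc) x y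
    ≡⟨ cong (_+_ (common (lo zero) (hi zero) x y))
            (∑common-chain (lo ∘ suc) (hi ∘ suc) (lo≤hi ∘ suc) (chain ∘ suc) x y) ⟩
  common (lo zero) (hi zero) x y + common (lo (suc zero)) (hi last) x y
    ≡⟨ cong (λ z → common (lo zero) (hi zero) x y + common z (hi last) x y) (chain zero) ⟩
  common (lo zero) (hi zero) x y + common (hi zero) (hi last) x y
    ≡⟨ sym (common-split-interval x y (lo≤hi zero) hi₀≤hi-last) ⟩
  common (lo zero) (hi last) x y ∎
  where
  open ≡-Reasoning
  last : Fin (suc (suc k))
  last = fromℕ (suc k)
  hi₀≤hi-last : hi zero ≤ hi last
  hi₀≤hi-last = subst (_≤ hi last) (chain zero)
    (chain⇒lo₀≤hi-last (lo ∘ suc) (hi ∘ suc) (lo≤hi ∘ suc) (chain ∘ suc))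

-- Only the first interval of a chain can start at or left of x: any other starts where its predecessor,
-- which meets (x, y], ends.
chain-meets⇒lo≤x⇒hi<y : (lo hi : Fin (suc (suc k)) → ℕ) → Chain lo hi → Meets lo hi x y →
  ∀ t → lo t ≤ x → hi t < y
chain-meets⇒lo≤x⇒hi<y {y = y} lo hi chain meets zero _ =
  subst (_< y) (chain zero) (common>0⇒lo<y (lo (suc zero)) (hi (suc zero)) (meets (suc zero)))
chain-meets⇒lo≤x⇒hi<y {x = x} lo hi chain meets (suc t) lo≤x =
  ⊥-elim (<⇒≱ (common>0⇒x<hi (lo (inject₁ t)) (hi (inject₁ t)) (meets (inject₁ t)))
               (subst (_≤ x) (chain t) lo≤x))

∑≥length⇔tiling : (lo hi f : Fin (suc (suc k)) → ℕ) → Separated lo hi → (∀ t → 0 < f t) →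
  (∀ t → f t ≤ common (lo t) (hi t) x y) →
  (∀ t → (lo t ≤ x → hi t < y) → f t ≡ common (lo t) (hi t) x y) →
  y ∸ x ≤ ∑ f ⇔ Tiling lo hi x y
∑≥length⇔tiling {k} {x} {y} lo hi f sep f>0 f≤common f≡common = mk⇔
  (λ tight → tight⇒tiling lo hi sep meets (≤-trans tight (∑-mono-≤ f≤common)))
  (λ (chain , lo₀≤x , y≤hi-last) → ≤-reflexive (begin
    y ∸ x                          ≡⟨ sym (common-window lo₀≤x y≤hi-last) ⟩
    common (lo zero) (hi last) x y ≡⟨ sym (∑common-chain lo hi lo≤hi chain x y) ⟩
    ∑common lo hi x y              ≡⟨ sym (∑-cong (λ t → f≡common t (starts-left chain t))) ⟩
    ∑ f                            ∎))
  where
  open ≡-Reasoning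
  last : Fin (suc (suc k))
  last = fromℕ (suc k)
  meets : Meets lo hi x y
  meets t = <-≤-trans (f>0 t) (f≤common t)
  lo≤hi : ∀ t → lo t ≤ hi t
  lo≤hi t = <⇒≤ (common>0⇒lo<hi (lo t) (hi t) (meets t))
  starts-left : Chain lo hi → ∀ t → lo t ≤ x → hi t < y
  starts-left chain = chain-meets⇒lo≤x⇒hi<y lo hi chain meets

M-after-≤ : ∀ J H → M J H ≤ common (b J) (a J) (b H) (suc (a H))
M-after-≤ J H with b J ≤? b H
... | yes _    = common-monoʸ {lo = b J} {a J} {b H} (n≤1+n (a H))
... | no bJ≰bH = ≤-reflexive (common-capˣ {hi = a J} {suc (a H)} (≰⇒> bJ≰bH) (<⇒≤ (≰⇒> bJ≰bH)))

M-after-≡ : ∀ J H → (b J ≤ b H → a J < suc (a H)) → M J H ≡ common (b J) (a J) (b H) (suc (a H))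
M-after-≡ J H ends-inside with b J ≤? b H
... | yes bJ≤bH = common-capʸ {lo = b J} {x = b H} (≤-pred (ends-inside bJ≤bH)) (<⇒≤ (ends-inside bJ≤bH))
... | no bJ≰bH  = common-capˣ {hi = a J} {suc (a H)} (≰⇒> bJ≰bH) (<⇒≤ (≰⇒> bJ≰bH))

∣∩∣-shift : ∀ H J → b H ≤ b J → ∣ H ∩ J ∣ ≡ common (suc (b J)) (suc (a J)) (b H) (suc (a H))
∣∩∣-shift H J bH≤bJ = trans (common-comm (b H) (a H) (b J) (a J))
                            (common-capˣ {hi = suc (a J)} {suc (a H)} (s≤s bH≤bJ) (≤-trans bH≤bJ (n≤1+n (b J))))

M-before-≤ : ∀ H J → M H J ≤ common (suc (b J)) (suc (a J)) (b H) (suc (a H))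
M-before-≤ H J with b H ≤? b J
... | yes bH≤bJ = ≤-reflexive (∣∩∣-shift H J bH≤bJ)
... | no _      = ≤-trans (≤-reflexive (common-comm (b H) (a H) (suc (b J)) (suc (a J))))
                          (common-monoʸ {lo = suc (b J)} {suc (a J)} {b H} (n≤1+n (a H)))

M-before-≡ : ∀ H J → (suc (b J) ≤ b H → suc (a J) < suc (a H)) →
  M H J ≡ common (suc (b J)) (suc (a J)) (b H) (suc (a H))
M-before-≡ H J ends-inside with b H ≤? b J
... | yes bH≤bJ = ∣∩∣-shift H J bH≤bJ
... | no bH≰bJ  = trans (common-comm (b H) (a H) (suc (b J)) (suc (a J)))
                        (common-capʸ {lo = suc (b J)} {x = b H} (≤-pred ends) (<⇒≤ ends))
  where
  ends : suc (a J) < suc (a H)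
  ends = ends-inside (≰⇒> bH≰bJ)

M>0⇒nonempty : ∀ J J′ → 0 < M J J′ → b J < a J × b J′ < a J′
M>0⇒nonempty J J′ meets with b J ≤? b J′
... | yes _ = common>0⇒lo<hi (b J) (a J) meets , common>0⇒x<y (b J) (a J) meets
... | no _  = common>0⇒lo<hi (b J) (a J) meets , ≤-pred (common>0⇒x<y (b J) (a J) meets)

M≡0⇒separated : ∀ J J′ → b J < a J → b J′ < a J′ → M J J′ ≡ 0 → a J ≤ b J′ ⊎ a J′ < b J
M≡0⇒separated J J′ bJ<aJ bJ′<aJ′ disjoint with b J ≤? b J′
... | yes bJ≤bJ′ with common≡0⇒apart bJ<aJ bJ′<aJ′ disjoint
...   | inj₁ aJ≤bJ′ = inj₁ aJ≤bJ′
...   | inj₂ aJ′≤bJ = ⊥-elim (<⇒≱ bJ′<aJ′ (≤-trans aJ′≤bJ bJ≤bJ′))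
M≡0⇒separated J J′ bJ<aJ bJ′<aJ′ disjoint | no bJ≰bJ′ with common≡0⇒apart bJ<aJ (s≤s bJ′<aJ′) disjoint
...   | inj₁ aJ≤1+bJ′ = ⊥-elim (<⇒≱ bJ<aJ (≤-trans aJ≤1+bJ′ (≰⇒> bJ≰bJ′)))
...   | inj₂ aJ′<bJ   = inj₂ aJ′<bJ

Mᵢⱼ-< : ∀ (R : HStrip n) {i i′} → i Fin.< i′ → Mᵢⱼ R i i′ ≡ M (R i) (R i′)
Mᵢⱼ-< R {i} {i′} i<i′ with i Fin.≤? i′
... | yes _   = refl
... | no i≰i′ = ⊥-elim (i≰i′ (<⇒≤ i<i′))

Mᵢⱼ-> : ∀ (R : HStrip n) {i i′} → i′ Fin.< i → Mᵢⱼ R i i′ ≡ M (R i′) (R i)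
Mᵢⱼ-> R {i} {i′} i′<i with i Fin.≤? i′
... | yes i≤i′ = ⊥-elim (<⇒≱ i′<i i≤i′)
... | no _     = refl

Mᵢⱼ>0⇒nonempty : ∀ (R : HStrip n) i i′ → 0 < Mᵢⱼ R i i′ → b (R i) < a (R i) × b (R i′) < a (R i′)
Mᵢⱼ>0⇒nonempty R i i′ meets with i Fin.≤? i′
... | yes _ = M>0⇒nonempty (R i) (R i′) meets
... | no _  = swap (M>0⇒nonempty (R i′) (R i) meets)

+m+n≤+o⇔n+m≤o : + m ℤ.+ + n ℤ.≤ + o ⇔ n + m ≤ o
+m+n≤+o⇔n+m≤o {m} {n} {o} = mk⇔
  (λ le → subst (_≤ o) (+-comm m n) (ℤ.drop‿+≤+ le))
  (λ le → +≤+ (subst (_≤ o) (+-comm n m) le))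

r+1≡a : ∀ R → r R ℤ.+ + 1 ≡ + a R
r+1≡a (zero  / _ ∣ _) = refl
r+1≡a (suc n / _ ∣ _) = cong +_ (+-comm n 1)

+≤r⇔<a : ∀ R → + m ℤ.≤ r R ⇔ m < a R
+≤r⇔<a (zero  / _ ∣ _) = mk⇔ (λ ()) (λ ())
+≤r⇔<a (suc n / _ ∣ _) = mk⇔ (λ { (+≤+ m≤n) → s≤s m≤n }) (λ { (s≤s m≤n) → +≤+ m≤n })

r≤r⇔a≤a : ∀ R R′ → r R ℤ.≤ r R′ ⇔ a R ≤ a R′
r≤r⇔a≤a (zero / _ ∣ _) (zero  / _ ∣ _) = mk⇔ (λ _ → z≤n) (λ _ → -≤- ≤-refl)
r≤r⇔a≤a (zero / _ ∣ _) (suc _ / _ ∣ _) = mk⇔ (λ _ → z≤n) (λ _ → -≤+)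
r≤r⇔a≤a (suc n / _ ∣ _) R′             = +≤r⇔<a R′

r+0≤r⇔a≤a : ∀ R R′ → r R ℤ.+ + 0 ℤ.≤ r R′ ⇔ a R ≤ a R′
r+0≤r⇔a≤a R R′ = subst (λ z → z ℤ.≤ r R′ ⇔ a R ≤ a R′) (sym (ℤ.+-identityʳ (r R))) (r≤r⇔a≤a R R′)

r+1≤r⇔a<a : ∀ R R′ → r R ℤ.+ + 1 ℤ.≤ r R′ ⇔ a R < a R′
r+1≤r⇔a<a R R′ = subst (λ z → z ℤ.≤ r R′ ⇔ a R < a R′) (sym (r+1≡a R)) (+≤r⇔<a R′)

×-⇔-insert : {P Q S T : Set} → S → (P × Q × T) ⇔ (P × Q × S × T)
×-⇔-insert s = mk⇔ (λ (p , q , t) → p , q , s , t) (λ (p , q , _ , t) → p , q , t)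

module _ {n m} (R : HStrip n) (j : Fin (suc (suc m)) → Fin n) (h : Fin n)
  (j-increasing : ∀ t t′ → t Fin.< t′ → j t Fin.< j t′)
  (j-disjoint : ∀ t t′ → t Fin.< t′ → Mᵢⱼ R (j t) (j t′) ≡ 0)
  (meets-h : ∀ t → 0 < Mᵢⱼ R (j t) h) where

  private
    last : Fin (suc (suc m))
    last = fromℕ (suc m)

    A B : ℕ
    A = a (R h)
    B = b (R h)

    bⱼ aⱼ : Fin (suc (suc m)) → ℕ
    bⱼ t = b (R (j t))
    aⱼ t = a (R (j t))

  Strict : Set
  Strict = suc ∣ R h ∣ᴿ ≤ ∑ (λ t → Mᵢⱼ R (j t) h)

  Tiles : ℕ → ℕ → Set
  Tiles s s′ = (∀ (t : Fin (suc m)) → l (R (j (suc t))) ≡ r (R (j (inject₁ t))) ℤ.+ + 1)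
             × (l (R (j zero)) ℤ.+ + s ℤ.≤ l (R h))
             × (l (R h) ℤ.≤ r (R h) ℤ.+ + s′)
             × (r (R h) ℤ.+ + s′ ℤ.≤ r (R (j last)))

  j-mono-≤ : ∀ {t t′} → t Fin.≤ t′ → j t Fin.≤ j t′
  j-mono-≤ {t} {t′} t≤t′ with t Fin.≟ t′
  ... | yes refl = ≤-refl
  ... | no t≢t′  = <⇒≤ (j-increasing t t′ (Fin.≤∧≢⇒< t≤t′ t≢t′))

  h<j₀⇒h<j : h Fin.< j zero → ∀ t → h Fin.< j t
  h<j₀⇒h<j h<j₀ t = <-≤-trans h<j₀ (j-mono-≤ z≤n)

  jₖ<h⇒j<h : j last Fin.< h → ∀ t → j t Fin.< h
  jₖ<h⇒j<h jₖ<h t = ≤-<-trans (j-mono-≤ (Fin.≤fromℕ t)) jₖ<h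

  Rh-nonempty : B < A
  Rh-nonempty = proj₂ (Mᵢⱼ>0⇒nonempty R (j zero) h (meets-h zero))

  separated : Separated bⱼ aⱼ
  separated t u t<u = M≡0⇒separated (R (j t)) (R (j u)) (nonempty t) (nonempty u)
    (trans (sym (Mᵢⱼ-< R (j-increasing t u t<u))) (j-disjoint t u t<u))
    where
    nonempty : ∀ t → bⱼ t < aⱼ t
    nonempty t = proj₁ (Mᵢⱼ>0⇒nonempty R (j t) h (meets-h t))

  chain⇔ : Chain bⱼ aⱼ ⇔ (∀ (t : Fin (suc m)) → l (R (j (suc t))) ≡ r (R (j (inject₁ t))) ℤ.+ + 1)
  chain⇔ = mk⇔ (λ chain t → trans (cong +_ (chain t)) (sym (r+1≡a (R (j (inject₁ t))))))
               (λ chain t → ℤ.+-injective (trans (chain t) (r+1≡a (R (j (inject₁ t))))))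

  strict⇔tiling : (lo hi : Fin (suc (suc m)) → ℕ) → Separated lo hi →
    (∀ t → Mᵢⱼ R (j t) h ≤ common (lo t) (hi t) B (suc A)) →
    (∀ t → (lo t ≤ B → hi t < suc A) → Mᵢⱼ R (j t) h ≡ common (lo t) (hi t) B (suc A)) →
    Strict ⇔ Tiling lo hi B (suc A)
  strict⇔tiling lo hi sep ≤common ≡common =
    subst (λ z → z ≤ ∑ (λ t → Mᵢⱼ R (j t) h) ⇔ Tiling lo hi B (suc A)) (+-∸-assoc 1 (b≤a (R h)))
      (∑≥length⇔tiling lo hi _ sep meets-h ≤common ≡common)

  before : h Fin.< j zero → Strict ⇔ Tiles (χ (h Fin.<? j zero)) (χ (j last Fin.<? h))
  before h<j₀
    rewrite cong χ (dec-yes-recompute (h Fin.<? j zero) h<j₀)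
          | cong χ (dec-no (j last Fin.<? h) (<-asym (h<j₀⇒h<j h<j₀ last))) =
    ⇔.trans (strict⇔tiling (suc ∘ bⱼ) (suc ∘ aⱼ) (Separated-suc separated)
              (λ t → subst (_≤ _) (sym (M≡ t)) (M-before-≤ (R h) (R (j t))))
              (λ t ends-inside → trans (M≡ t) (M-before-≡ (R h) (R (j t)) ends-inside)))
    (⇔.trans (⇔.trans (Chain-suc⇔ {lo = bⱼ} {aⱼ}) chain⇔
               ×-⇔ ⇔.sym (+m+n≤+o⇔n+m≤o {bⱼ zero} {1} {B})
               ×-⇔ ⇔.trans (mk⇔ ≤-pred s≤s) (⇔.sym (r+0≤r⇔a≤a (R h) (R (j last)))))
             (×-⇔-insert (subst (+ B ℤ.≤_) (sym (ℤ.+-identityʳ (r (R h))))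
                                 (Equivalence.from (+≤r⇔<a (R h)) Rh-nonempty))))
    where
    M≡ : ∀ t → Mᵢⱼ R (j t) h ≡ M (R h) (R (j t))
    M≡ t = Mᵢⱼ-> R (h<j₀⇒h<j h<j₀ t)

  after : j last Fin.< h → Strict ⇔ Tiles (χ (h Fin.<? j zero)) (χ (j last Fin.<? h))
  after jₖ<h
    rewrite cong χ (dec-no (h Fin.<? j zero) (<-asym (jₖ<h⇒j<h jₖ<h zero)))
          | cong χ (dec-yes-recompute (j last Fin.<? h) jₖ<h) =
    ⇔.trans (strict⇔tiling bⱼ aⱼ separated
              (λ t → subst (_≤ _) (sym (M≡ t)) (M-after-≤ (R (j t)) (R h)))
              (λ t ends-inside → trans (M≡ t) (M-after-≡ (R (j t)) (R h) ends-inside)))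
    (⇔.trans (chain⇔
               ×-⇔ ⇔.sym (+m+n≤+o⇔n+m≤o {bⱼ zero} {0} {B})
               ×-⇔ ⇔.sym (r+1≤r⇔a<a (R h) (R (j last))))
             (×-⇔-insert (subst (+ B ℤ.≤_) (sym (r+1≡a (R h))) (+≤+ (b≤a (R h))))))
    where
    M≡ : ∀ t → Mᵢⱼ R (j t) h ≡ M (R (j t)) (R h)
    M≡ t = Mᵢⱼ-< R (jₖ<h⇒j<h jₖ<h t)

proposition5p32 :
    ∀ (n : ℕ) (R : HStrip n)
      -- k = m + 2 ≥ 2 ; the subsequence indices j_1 < ⋯ < j_k
      (m : ℕ) (j : Fin (suc (suc m)) → Fin n) (h : Fin n) →
      (∀ t t′ → t Fin.< t′ → j t Fin.< j t′) →
      (∀ t t′ → t Fin.< t′ → Mᵢⱼ R (j t) (j t′) ≡ 0) →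
      (h Fin.< j zero ⊎ j (fromℕ (suc m)) Fin.< h) →
      (∀ t → 0 ℕ.< Mᵢⱼ R (j t) h) →
      (suc ∣ R h ∣ᴿ ℕ.≤ ∑ (λ t → Mᵢⱼ R (j t) h)
        ⇔
       ((∀ (t : Fin (suc m)) → l (R (j (suc t))) ≡ r (R (j (inject₁ t))) ℤ.+ + 1)
        × (l (R (j zero)) ℤ.+ + χ (h Fin.<? j zero) ℤ.≤ l (R h))
        × (l (R h) ℤ.≤ r (R h) ℤ.+ + χ (j (fromℕ (suc m)) Fin.<? h))
        × (r (R h) ℤ.+ + χ (j (fromℕ (suc m)) Fin.<? h) ℤ.≤ r (R (j (fromℕ (suc m)))))))
proposition5p32 n R m j h j-increasing j-disjoint (inj₁ h<j₀) meets-h =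
  before R j h j-increasing j-disjoint meets-h h<j₀
proposition5p32 n R m j h j-increasing j-disjoint (inj₂ jₖ<h) meets-h =
  after R j h j-increasing j-disjoint meets-h jₖ<h
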